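{- Let $G$ be the infinite square grid, with vertex set $\mathbb{Z}\times\mathbb{Z}$, where two vertices $(u_1,u_2),(v_1,v_2)$ are adjacent iff $|u_1-v_1|+|u_2-v_2|=1$. For $k\geq 1$ let $\lambda_k$ be the $L(k,k-1,\ldots,2,1)$-labeling number of $G$. Then \[ \lambda_k \geq \begin{cases} \frac{2}{3}p(p+1)(2p+1)+2 & \text{if } k=2p \text{ is even},\\ \frac{2}{3}p(p+1)(2p+3)+2 & \text{if } k=2p+1 \text{ is odd}.\end{cases} \]
   Context: The graph distance $d(u,v)$ between vertices $u=(u_1,u_2)$ and $v=(v_1,v_2)$ of the square grid is the Manhattan distance $|u_1-v_1|+|u_2-v_2|$. For fixed $k,\lambda\in\mathbb{Z}^+$, a $\lambda$-$L(k,k-1,\ldots,2,1)$-labeling of a graph $G=(V,E)$ is a map $f:V\to\{0,1,\ldots,\lambda-1\}$ such that $|f(x)-f(y)|\geq k+1-d(x,y)$ for all distinct $x,y\in V$ (so adjacent vertices get labels differing by at least $k$, vertices at distance $2$ by at least $k-1$, ..., vertices at distance $k$ by at least $1$, and vertices at distance $\geq k+1$ are unconstrained). The $L(k,k-1,\ldots,2,1)$-labeling number $\lambda_k$ of $G$ is the smallest $\lambda$ for which a $\lambda$-$L(k,k-1,\ldots,2,1)$-labeling of $G$ exists. -}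

module Defs where

open import Data.Nat using (ℕ; suc; _+_; _*_; _∸_; _≤_; _<_)
open import Data.Integer as ℤ using (ℤ; ∣_∣)
open import Data.Product using (_×_; _,_; proj₁; proj₂)
open import Relation.Binary.PropositionalEquality using (_≡_)
open import Relation.Nullary using (¬_)

Vertex : Set
Vertex = ℤ × ℤ

dist : Vertex → Vertex → ℕ
dist (u₁ , u₂) (v₁ , v₂) = ∣ u₁ ℤ.- v₁ ∣ + ∣ u₂ ℤ.- v₂ ∣

absDiff : ℕ → ℕ → ℕ
absDiff a b = (a ∸ b) + (b ∸ a)

-- f is a λ-L(k,k-1,...,1)-labeling of the grid:
-- labels in {0,...,λ-1}, and |f x - f y| ≥ k+1-d(x,y) for distinct x,y.
-- (For d(x,y) ≥ k+1 the truncated subtraction gives 0: no constraint.)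
IsLabeling : ℕ → ℕ → (Vertex → ℕ) → Set
IsLabeling k lam f =
  (∀ x → f x < lam) ×
  (∀ x y → ¬ (x ≡ y) → (suc k ∸ dist x y) ≤ absDiff (f x) (f y))

IsLabelingNumber : ℕ → ℕ → Set
IsLabelingNumber k lam =
  (Data.Product.Σ (Vertex → ℕ) (IsLabeling k lam)) ×
  (∀ μ (f : Vertex → ℕ) → IsLabeling k μ f → lam ≤ μ)

module Submission where

open import Defs
open import Function using (_∘_)
open import Algebra.Properties.CommutativeSemigroup using (interchange)
open import Data.Nat using (ℕ; zero; suc; pred; _+_; _*_; _∸_; _≤_; _<_; z≤n; s≤s)
open import Data.Nat.Properties
open import Data.Nat.ListAction using (sum)
open import Data.Nat.ListAction.Properties using (sum-++; sum-↭)
open import Data.Nat.Tactic.RingSolver using (solve; solve-∀)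
open import Data.Integer as ℤ using (∣_∣)
import Data.Integer.Properties as ℤ
open import Data.Product using (_×_; _,_; proj₁; proj₂; map₁)
open import Data.List as List using (List; []; _∷_; _++_; length; map; concat; foldl)
open import Data.List.Properties using (length-map; length-++; map-++)
open import Data.List.Membership.Propositional.Properties using (∈-map⁻)
open import Data.List.Relation.Unary.All as All using (All; []; _∷_)
import Data.List.Relation.Unary.All.Properties as All
open import Data.List.Relation.Unary.AllPairs using ([]; _∷_)
open import Data.List.Relation.Unary.Linked using (Linked; _∷_)
open import Data.List.Relation.Unary.Unique.Propositional using (Unique)
import Data.List.Relation.Unary.Unique.Propositional.Properties as Unique
open import Data.List.Relation.Binary.Disjoint.Propositional using (Disjoint)
open import Data.List.Relation.Binary.Permutation.Propositional using (↭-sym; ↭⇒↭ₛ)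
import Data.List.Relation.Binary.Permutation.Propositional.Properties as ↭
import Data.List.Relation.Binary.Permutation.Setoid.Properties as ↭ₛ
import Data.List.Sort as Sort
import Relation.Binary.Construct.On as On
open import Relation.Binary.PropositionalEquality
open import Relation.Nullary using (contradiction)

-- List distinct vertices in increasing order of their labels. Consecutive
-- vertices x, y satisfy f y − f x ≥ k + 1 − d(x, y) ≥ k + 1 − ‖x‖ − ‖y‖,
-- where ‖v‖ is the distance from v to the origin. Telescoping, n + 1
-- distinct vertices force λ − 1 ≥ n(k + 1) − 2 Σ ‖v‖ + 1, the last 1 because
-- the two extreme vertices are not both the origin. The diamond ‖v‖ ≤ r has
-- 2r(r + 1) + 1 vertices and Σ ‖v‖ = (2/3) r(r + 1)(2r + 1); the radius
-- r = p gives the bound for k = 2p and for k = 2p + 1 (the case k = 1 needs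
-- only an edge).

last : {A : Set} → A → List A → A
last = foldl (λ _ y → y)

All-last : {A : Set} {P : A → Set} → ∀ y ys → All P (y ∷ ys) → P (last y ys)
All-last y [] (py ∷ []) = py
All-last y (z ∷ zs) (_ ∷ pzs) = All-last z zs pzs

sum-map-const : {A : Set} (g : A → ℕ) {c : ℕ} → ∀ xs → All (λ x → g x ≡ c) xs →
  sum (map g xs) ≡ length xs * c
sum-map-const g [] [] = refl
sum-map-const g (x ∷ xs) (gx≡c ∷ gxs≡c) = cong₂ _+_ gx≡c (sum-map-const g xs gxs≡c)

length-concat-map : {A B : Set} (gs : List (A → B)) (xs : List A) →
  length (concat (map (λ g → map g xs) gs)) ≡ length gs * length xs
length-concat-map [] xs = refl
length-concat-map (g ∷ gs) xs =
  trans (length-++ (map g xs)) (cong₂ _+_ (length-map g xs) (length-concat-map gs xs))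

map-disjoint : {A B : Set} (g h : A → B) {xs ys : List A} → (∀ p q → g p ≢ h q) →
  Disjoint (map g xs) (map h ys)
map-disjoint g h g≢h (v∈gxs , v∈hys) with ∈-map⁻ g v∈gxs | ∈-map⁻ h v∈hys
... | p , _ , refl | q , _ , v≡hq = g≢h p q v≡hq

norm : Vertex → ℕ
norm (a , b) = ∣ a ∣ + ∣ b ∣

normSum : List Vertex → ℕ
normSum S = sum (map norm S)

normSum-++ : ∀ xs ys → normSum (xs ++ ys) ≡ normSum xs + normSum ys
normSum-++ xs ys = trans (cong sum (map-++ norm xs ys)) (sum-++ (map norm xs) (map norm ys))

origin : Vertex
origin = (ℤ.+ 0 , ℤ.+ 0)

dist≤norm+norm : ∀ x y → dist x y ≤ norm x + norm y
dist≤norm+norm (a , b) (c , d) = begin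
  ∣ a ℤ.- c ∣ + ∣ b ℤ.- d ∣
    ≤⟨ +-mono-≤ (ℤ.∣i-j∣≤∣i∣+∣j∣ a c) (ℤ.∣i-j∣≤∣i∣+∣j∣ b d) ⟩
  (∣ a ∣ + ∣ c ∣) + (∣ b ∣ + ∣ d ∣)
    ≡⟨ interchange +-commutativeSemigroup (∣ a ∣) (∣ c ∣) (∣ b ∣) (∣ d ∣) ⟩
  (∣ a ∣ + ∣ b ∣) + (∣ c ∣ + ∣ d ∣)
    ∎
  where open ≤-Reasoning

norm≡0⇒≡origin : ∀ x → norm x ≡ 0 → x ≡ origin
norm≡0⇒≡origin (a , b) n≡0 =
  cong₂ _,_ (ℤ.∣i∣≡0⇒i≡0 (m+n≡0⇒m≡0 ∣ a ∣ n≡0)) (ℤ.∣i∣≡0⇒i≡0 (m+n≡0⇒n≡0 ∣ a ∣ n≡0))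

≢⇒0<norm+norm : ∀ {x y} → x ≢ y → 0 < norm x + norm y
≢⇒0<norm+norm {x} {y} x≢y = n≢0⇒n>0 λ sum≡0 →
  x≢y (trans (norm≡0⇒≡origin x (m+n≡0⇒m≡0 (norm x) sum≡0))
             (sym (norm≡0⇒≡origin y (m+n≡0⇒n≡0 (norm x) sum≡0))))

chain-step : ∀ a b c K n u v w s →
  a + K ≤ b + (u + v) → b + n * K + (v + w) ≤ c + 2 * s →
  a + suc n * K + (u + w) ≤ c + 2 * (u + s)
chain-step a b c K n u v w s gap rest = begin
  a + suc n * K + (u + w)            ≡⟨ split-head a K n u w ⟩
  (a + K) + (n * K + (u + w))        ≤⟨ +-monoˡ-≤ (n * K + (u + w)) gap ⟩
  (b + (u + v)) + (n * K + (u + w))  ≡⟨ regroup b K n u v w ⟩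
  (b + n * K + (v + w)) + (u + u)    ≤⟨ +-monoˡ-≤ (u + u) rest ⟩
  (c + 2 * s) + (u + u)              ≡⟨ merge c s u ⟩
  c + 2 * (u + s)                    ∎
  where
  open ≤-Reasoning
  split-head : ∀ a K n u w → a + suc n * K + (u + w) ≡ (a + K) + (n * K + (u + w))
  split-head = solve-∀
  regroup : ∀ b K n u v w → (b + (u + v)) + (n * K + (u + w)) ≡ (b + n * K + (v + w)) + (u + u)
  regroup = solve-∀
  merge : ∀ c s u → (c + 2 * s) + (u + u) ≡ c + 2 * (u + s)
  merge = solve-∀

span-step : ∀ a c n w s Λ → 0 < w → a + n + w ≤ c + s → c < Λ → n + 2 ≤ Λ + s
span-step a c n w s Λ 0<w chain c<Λ = begin
  n + 2            ≡⟨ +-assoc n 1 1 ⟨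
  (n + 1) + 1      ≤⟨ +-monoˡ-≤ 1 (+-mono-≤ (m≤n+m n a) 0<w) ⟩
  (a + n + w) + 1  ≤⟨ +-monoˡ-≤ 1 chain ⟩
  (c + s) + 1      ≡⟨ +-comm (c + s) 1 ⟩
  suc c + s        ≤⟨ +-monoˡ-≤ s c<Λ ⟩
  Λ + s            ∎
  where open ≤-Reasoning

module Labelling {k Λ : ℕ} {f : Vertex → ℕ} (isLabelling : IsLabeling k Λ f) where

  private
    K : ℕ
    K = suc k

    _≤ᶠ_ : Vertex → Vertex → Set
    x ≤ᶠ y = f x ≤ f y

  label-gap : ∀ {x y} → x ≢ y → f x ≤ f y → f x + K ≤ f y + (norm x + norm y)
  label-gap {x} {y} x≢y fx≤fy = begin
    f x + K                   ≤⟨ +-monoʳ-≤ (f x) (m≤n+m∸n K d) ⟩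
    f x + (d + (K ∸ d))       ≤⟨ +-monoʳ-≤ (f x) (+-mono-≤ (dist≤norm+norm x y) K∸d≤gap) ⟩
    f x + (N + (f y ∸ f x))   ≡⟨ cong (f x +_) (+-comm N (f y ∸ f x)) ⟩
    f x + ((f y ∸ f x) + N)   ≡⟨ +-assoc (f x) (f y ∸ f x) N ⟨
    (f x + (f y ∸ f x)) + N   ≡⟨ cong (_+ N) (m+[n∸m]≡n fx≤fy) ⟩
    f y + N                   ∎
    where
    open ≤-Reasoning
    d = dist x y
    N = norm x + norm y
    K∸d≤gap : K ∸ d ≤ f y ∸ f x
    K∸d≤gap = subst (K ∸ d ≤_) (cong (_+ (f y ∸ f x)) (m≤n⇒m∸n≡0 fx≤fy)) (proj₂ isLabelling x y x≢y)

  sorted-chain : ∀ x xs → Linked _≤ᶠ_ (x ∷ xs) → Unique (x ∷ xs) →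
    f x + length xs * K + (norm x + norm (last x xs)) ≤ f (last x xs) + 2 * normSum (x ∷ xs)
  sorted-chain x [] _ _ = ≤-reflexive (singleton (f x) K (norm x))
    where
    singleton : ∀ a K n → a + 0 * K + (n + n) ≡ a + 2 * (n + 0)
    singleton = solve-∀
  sorted-chain x (y ∷ ys) (fx≤fy ∷ sorted) ((x≢y ∷ _) ∷ unique) =
    chain-step (f x) (f y) (f z) K (length ys) (norm x) (norm y) (norm z) (normSum (y ∷ ys))
      (label-gap x≢y fx≤fy) (sorted-chain y ys sorted unique)
    where z = last y ys

  sorted-span : ∀ x y ys → Linked _≤ᶠ_ (x ∷ y ∷ ys) → Unique (x ∷ y ∷ ys) →
    length (y ∷ ys) * K + 2 ≤ Λ + 2 * normSum (x ∷ y ∷ ys)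
  sorted-span x y ys sorted unique@(x∉ ∷ _) =
    span-step (f x) (f z) (length (y ∷ ys) * K) (norm x + norm z) (2 * normSum (x ∷ y ∷ ys)) Λ
      (≢⇒0<norm+norm (All-last y ys x∉)) (sorted-chain x (y ∷ ys) sorted unique) (proj₁ isLabelling z)
    where z = last y ys

  open Sort (On.decTotalOrder ≤-decTotalOrder f) using (sort; sort-↭; sort-↗)

  span : ∀ {n} S → Unique S → length S ≡ suc n → 0 < n → n * K + 2 ≤ Λ + 2 * normSum S
  span S unique |S|≡1+n 0<n with sort S | sort-↭ S | sort-↗ S
  ... | x ∷ y ∷ ys | T↭S | sorted =
    subst₂ (λ m s → m * K + 2 ≤ Λ + 2 * s)
      (suc-injective (trans (↭.↭-length T↭S) |S|≡1+n)) (sum-↭ (↭.map⁺ norm T↭S))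
      (sorted-span x y ys sorted (↭ₛ.Unique-resp-↭ (setoid Vertex) (↭⇒↭ₛ (↭-sym T↭S)) unique))
  ... | [] | T↭S | _ = contradiction (trans (↭.↭-length T↭S) |S|≡1+n) λ ()
  ... | x ∷ [] | T↭S | _ = contradiction (suc-injective (trans (↭.↭-length T↭S) |S|≡1+n)) (<⇒≢ 0<n)

  k<Λ : k < Λ
  k<Λ = +-cancelʳ-≤ 2 K Λ (subst (λ m → m + 2 ≤ Λ + 2) (*-identityˡ K) (span edge edge-unique refl (s≤s z≤n)))
    where
    edge : List Vertex
    edge = origin ∷ (ℤ.+ 1 , ℤ.+ 0) ∷ []
    edge-unique : Unique edge
    edge-unique = ((λ ()) ∷ []) ∷ [] ∷ []

antidiagonal : ℕ → List (ℕ × ℕ)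
antidiagonal zero = (0 , 0) ∷ []
antidiagonal (suc m) = (0 , suc m) ∷ map (map₁ suc) (antidiagonal m)

antidiagonal-sum : ∀ m → All (λ (a , b) → a + b ≡ m) (antidiagonal m)
antidiagonal-sum zero = refl ∷ []
antidiagonal-sum (suc m) = refl ∷ All.map⁺ (All.map (cong suc) (antidiagonal-sum m))

length-antidiagonal : ∀ m → length (antidiagonal m) ≡ suc m
length-antidiagonal zero = refl
length-antidiagonal (suc m) = cong suc (trans (length-map (map₁ suc) (antidiagonal m)) (length-antidiagonal m))

antidiagonal-unique : ∀ m → Unique (antidiagonal m)
antidiagonal-unique zero = [] ∷ []
antidiagonal-unique (suc m) =
  All.map⁺ (All.universal (λ _ ()) (antidiagonal m)) ∷ Unique.map⁺ (cong (map₁ pred)) (antidiagonal-unique m)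

rotate : Vertex → Vertex
rotate (a , b) = (ℤ.- b , a)

norm-rotate : ∀ v → norm (rotate v) ≡ norm v
norm-rotate (a , b) = trans (cong (_+ ∣ a ∣) (ℤ.∣-i∣≡∣i∣ b)) (+-comm ∣ b ∣ ∣ a ∣)

rotate-injective : ∀ {v w} → rotate v ≡ rotate w → v ≡ w
rotate-injective eq = cong₂ _,_ (cong proj₂ eq) (ℤ.neg-injective (cong proj₁ eq))

-- As (a , b) runs over the antidiagonal a + b = m, corner (a , b) runs over the
-- vertices of norm m + 1 with x ≥ 0 and y > 0; its three further quarter turns
-- cover the rest of that sphere, disjointly.
corner : ℕ × ℕ → Vertex
corner (a , b) = (ℤ.+ a , ℤ.+ suc b)

corner-injective : ∀ {p q} → corner p ≡ corner q → p ≡ q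
corner-injective eq = cong₂ _,_ (ℤ.+-injective (cong proj₁ eq)) (suc-injective (ℤ.+-injective (cong proj₂ eq)))

norm-corner : ∀ p → norm (corner p) ≡ suc (proj₁ p + proj₂ p)
norm-corner (a , b) = +-suc a b

quarterTurns : List (ℕ × ℕ → Vertex)
quarterTurns = corner ∷ rotate ∘ corner ∷ rotate ∘ rotate ∘ corner ∷ rotate ∘ rotate ∘ rotate ∘ corner ∷ []

side : ℕ → (ℕ × ℕ → Vertex) → List Vertex
side m g = map g (antidiagonal m)

shell : ℕ → List Vertex
shell m = concat (map (side m) quarterTurns)

length-shell : ∀ m → length (shell m) ≡ 4 * suc m
length-shell m = trans (length-concat-map quarterTurns (antidiagonal m)) (cong (4 *_) (length-antidiagonal m))

shell-norm : ∀ m → All (λ v → norm v ≡ suc m) (shell m)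
shell-norm m = All.concat⁺ (All.map⁺ {f = side m} (All.map (λ {g} → side-norm g) quarterTurns-norm))
  where
  quarterTurns-norm : All (λ g → ∀ p → norm (g p) ≡ norm (corner p)) quarterTurns
  quarterTurns-norm = (λ _ → refl)
                    ∷ (λ p → norm-rotate (corner p))
                    ∷ (λ p → trans (norm-rotate (rotate (corner p))) (norm-rotate (corner p)))
                    ∷ (λ p → trans (norm-rotate (rotate (rotate (corner p))))
                                   (trans (norm-rotate (rotate (corner p))) (norm-rotate (corner p))))
                    ∷ []
  side-norm : ∀ g → (∀ p → norm (g p) ≡ norm (corner p)) → All (λ v → norm v ≡ suc m) (side m g)
  side-norm g g-norm = All.map⁺ (All.map (λ {p} a+b≡m → trans (g-norm p) (trans (norm-corner p) (cong suc a+b≡m)))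
                                         (antidiagonal-sum m))

shell-unique : ∀ m → Unique (shell m)
shell-unique m = Unique.concat⁺
  (All.map⁺ {f = side m}
    ( side-unique _ corner-injective
    ∷ side-unique _ (corner-injective ∘ rotate-injective)
    ∷ side-unique _ (corner-injective ∘ rotate-injective ∘ rotate-injective)
    ∷ side-unique _ (corner-injective ∘ rotate-injective ∘ rotate-injective ∘ rotate-injective)
    ∷ []))
  ( (map-disjoint _ _ (λ _ _ ()) ∷ map-disjoint _ _ (λ _ _ ()) ∷ map-disjoint _ _ corner≢rotate³ ∷ [])
  ∷ (map-disjoint _ _ (λ _ _ ()) ∷ map-disjoint _ _ (λ _ _ ()) ∷ [])
  ∷ (map-disjoint _ _ rotate²≢rotate³ ∷ [])
  ∷ [] ∷ [])
  where
  side-unique : ∀ g → (∀ {p q} → g p ≡ g q → p ≡ q) → Unique (side m g)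
  side-unique _ g-injective = Unique.map⁺ g-injective (antidiagonal-unique m)
  corner≢rotate³ : ∀ p q → corner p ≢ rotate (rotate (rotate (corner q)))
  corner≢rotate³ _ (zero , _) ()
  corner≢rotate³ _ (suc _ , _) ()
  rotate²≢rotate³ : ∀ p q → rotate (rotate (corner p)) ≢ rotate (rotate (rotate (corner q)))
  rotate²≢rotate³ (zero , _) _ ()
  rotate²≢rotate³ (suc _ , _) _ ()

normSum-shell : ∀ m → normSum (shell m) ≡ 4 * suc m * suc m
normSum-shell m = trans (sum-map-const norm (shell m) (shell-norm m)) (cong (_* suc m) (length-shell m))

diamond : ℕ → List Vertex
diamond zero = origin ∷ []
diamond (suc m) = shell m ++ diamond m

diamond-norm : ∀ r → All (λ v → norm v ≤ r) (diamond r)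
diamond-norm zero = z≤n ∷ []
diamond-norm (suc m) = All.++⁺ (All.map ≤-reflexive (shell-norm m)) (All.map m≤n⇒m≤1+n (diamond-norm m))

diamond-unique : ∀ r → Unique (diamond r)
diamond-unique zero = [] ∷ []
diamond-unique (suc m) = Unique.++⁺ (shell-unique m) (diamond-unique m) λ (v∈shell , v∈diamond) →
  1+n≰n (subst (_≤ m) (All.lookup (shell-norm m) v∈shell) (All.lookup (diamond-norm m) v∈diamond))

length-diamond : ∀ r → length (diamond r) ≡ suc (2 * (r * suc r))
length-diamond zero = refl
length-diamond (suc m) = begin
  length (shell m ++ diamond m)                ≡⟨ length-++ (shell m) ⟩
  length (shell m) + length (diamond m)        ≡⟨ cong₂ _+_ (length-shell m) (length-diamond m) ⟩
  4 * suc m + suc (2 * (m * suc m))            ≡⟨ solve List.[ m ] ⟩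
  suc (2 * (suc m * suc (suc m)))              ∎
  where open ≡-Reasoning

normSum-diamond : ∀ r → 3 * normSum (diamond r) ≡ 2 * (r * (r + 1) * (2 * r + 1))
normSum-diamond zero = refl
normSum-diamond (suc m) = begin
  3 * normSum (shell m ++ diamond m)                        ≡⟨ cong (3 *_) (normSum-++ (shell m) (diamond m)) ⟩
  3 * (normSum (shell m) + normSum (diamond m))             ≡⟨ *-distribˡ-+ 3 (normSum (shell m)) (normSum (diamond m)) ⟩
  3 * normSum (shell m) + 3 * normSum (diamond m)           ≡⟨ cong₂ _+_ (cong (3 *_) (normSum-shell m)) (normSum-diamond m) ⟩
  3 * (4 * suc m * suc m) + 2 * (m * (m + 1) * (2 * m + 1)) ≡⟨ solve List.[ m ] ⟩
  2 * (suc m * (suc m + 1) * (2 * suc m + 1))               ∎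
  where open ≡-Reasoning

diamond-span : ∀ {k Λ f} → IsLabeling k Λ f → ∀ r → 0 < r →
  2 * (r * suc r) * suc k + 2 ≤ Λ + 2 * normSum (diamond r)
diamond-span isLabelling (suc r) _ =
  Labelling.span isLabelling (diamond (suc r)) (diamond-unique (suc r)) (length-diamond (suc r)) (s≤s z≤n)

tripled : ∀ a Λ s t → a + 2 ≤ Λ + 2 * s → 3 * s ≡ t → 3 * a + 6 ≤ 3 * Λ + 2 * t
tripled a Λ s t bound 3s≡t = begin
  3 * a + 6            ≡⟨ *-distribˡ-+ 3 a 2 ⟨
  3 * (a + 2)          ≤⟨ *-monoʳ-≤ 3 bound ⟩
  3 * (Λ + 2 * s)      ≡⟨ solve (Λ List.∷ s List.∷ List.[]) ⟩
  3 * Λ + 2 * (3 * s)  ≡⟨ cong (λ x → 3 * Λ + 2 * x) 3s≡t ⟩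
  3 * Λ + 2 * t        ∎
  where open ≤-Reasoning

even-bound : ∀ r Λ s →
  2 * (r * suc r) * suc (2 * r) + 2 ≤ Λ + 2 * s → 3 * s ≡ 2 * (r * (r + 1) * (2 * r + 1)) →
  2 * (r * (r + 1) * (2 * r + 1)) + 6 ≤ 3 * Λ
even-bound r Λ s bound 3s≡ = +-cancelʳ-≤ (2 * (2 * (r * (r + 1) * (2 * r + 1)))) _ _ (begin
  2 * (r * (r + 1) * (2 * r + 1)) + 6 + 2 * (2 * (r * (r + 1) * (2 * r + 1)))  ≡⟨ solve List.[ r ] ⟩
  3 * (2 * (r * suc r) * suc (2 * r)) + 6                                      ≤⟨ tripled _ Λ s _ bound 3s≡ ⟩
  3 * Λ + 2 * (2 * (r * (r + 1) * (2 * r + 1)))                                ∎)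
  where open ≤-Reasoning

odd-bound : ∀ p Λ s →
  2 * (p * suc p) * suc (2 * p + 1) + 2 ≤ Λ + 2 * s → 3 * s ≡ 2 * (p * (p + 1) * (2 * p + 1)) →
  2 * (p * (p + 1) * (2 * p + 3)) + 6 ≤ 3 * Λ
-- The diamond actually yields 2p + 4 in place of 2p + 3; the slack is dropped.
odd-bound p Λ s bound 3s≡ = +-cancelʳ-≤ (2 * (2 * (p * (p + 1) * (2 * p + 1)))) _ _ (begin
  2 * (p * (p + 1) * (2 * p + 3)) + 6 + 2 * (2 * (p * (p + 1) * (2 * p + 1)))
    ≤⟨ m≤m+n _ (2 * (p * (p + 1))) ⟩
  2 * (p * (p + 1) * (2 * p + 3)) + 6 + 2 * (2 * (p * (p + 1) * (2 * p + 1))) + 2 * (p * (p + 1))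
    ≡⟨ solve List.[ p ] ⟩
  3 * (2 * (p * suc p) * suc (2 * p + 1)) + 6
    ≤⟨ tripled _ Λ s _ bound 3s≡ ⟩
  3 * Λ + 2 * (2 * (p * (p + 1) * (2 * p + 1)))
    ∎)
  where open ≤-Reasoning

theorem1 : ∀ (λk : ℕ) →
    (∀ p → IsLabelingNumber (2 * suc p) λk →
      2 * (suc p * (suc p + 1) * (2 * suc p + 1)) + 6 ≤ 3 * λk) ×
    (∀ p → IsLabelingNumber (2 * p + 1) λk →
      2 * (p * (p + 1) * (2 * p + 3)) + 6 ≤ 3 * λk)
theorem1 λk = even , odd
  where
  even : ∀ p → IsLabelingNumber (2 * suc p) λk → 2 * (suc p * (suc p + 1) * (2 * suc p + 1)) + 6 ≤ 3 * λk
  even p ((_ , isLabelling) , _) =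
    even-bound (suc p) λk (normSum (diamond (suc p)))
      (diamond-span isLabelling (suc p) (s≤s z≤n)) (normSum-diamond (suc p))
  odd : ∀ p → IsLabelingNumber (2 * p + 1) λk → 2 * (p * (p + 1) * (2 * p + 3)) + 6 ≤ 3 * λk
  odd zero ((_ , isLabelling) , _) = *-monoʳ-≤ 3 (Labelling.k<Λ isLabelling)
  odd (suc q) ((_ , isLabelling) , _) =
    odd-bound (suc q) λk (normSum (diamond (suc q)))
      (diamond-span isLabelling (suc q) (s≤s z≤n)) (normSum-diamond (suc q))
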